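{- Let $\mathbf{N}=\langle \mathbf{A},\blacksquare,\Diamond_N\rangle$ be a modal Nelson lattice. Then $\mathbf{N}$ is isomorphic to $\mathbf{N}(\mathbf{M}_\mathbf{N}^*,F^*)$, where $F^*=\{(a\vee\sim a)^2 : a\in A\}$. The isomorphism is $h\colon A\to R(\mathbf{H}^*,F^*)$, $h(a)=(a^2,(\sim a)^2)$.
   Context: A Nelson lattice is an involutive residuated lattice $\mathbf{A}=\langle A,\wedge,\vee,*,\Rightarrow,\top,\bot\rangle$ (with $\sim a=a\Rightarrow\bot$, $\sim\sim a=a$, $a^2=a*a$) satisfying $((a^2\Rightarrow b)\wedge((\sim b)^2\Rightarrow\sim a))\Rightarrow(a\Rightarrow b)=\top$. A modal Nelson lattice (MN-lattice) is $\mathbf{N}=\langle\mathbf{A},\blacksquare,\Diamond_N\rangle$ with $\mathbf{A}$ a Nelson lattice and $\blacksquare,\Diamond_N$ unary operators (here $\Diamond_N$ denotes the Nelson-level diamond, written as a black lozenge in the paper) such that for all $a,b$: (mN1) $\Diamond_N a=\sim\blacksquare\sim a$; (mN2) if $a^2=b^2$ then $(\blacksquare a)^2=(\blacksquare b)^2$ and $(\Diamond_N a)^2=(\Diamond_N b)^2$; (mN3) $(\blacksquare a\wedge\Diamond_N(\sim a^2\wedge b))^2=\bot$. For a Heyting algebra $\mathbf{H}$ (implication $\rightharpoonup$, $-a=a\rightharpoonup\bot$), a Boolean filter is a filter containing all dense elements ($a$ with $--a=\top$). A modal Heyting algebra is $\mathbf{M}=\langle\mathbf{H},\square,\Diamond\rangle$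 with $\mathbf{H}$ a Heyting algebra and unary $\square,\Diamond$ satisfying $\square a\wedge\Diamond(-a\wedge b)=\bot$ (equivalently: $a\wedge b=\bot$ implies $\square a\wedge\Diamond b=\bot$). For such $\mathbf{M}$ and a Boolean filter $F$ satisfying (F): if $a\wedge b=\bot$ and $a\vee b\in F$ then $\square a\vee\Diamond b\in F$, define $R(\mathbf{H},F)=\{(x,y)\in H\times H: x\wedge y=\bot,\ x\vee y\in F\}$ with $(x,y)\vee(s,t)=(x\vee s,y\wedge t)$, $(x,y)\wedge(s,t)=(x\wedge s,y\vee t)$, $(x,y)*(s,t)=(x\wedge s,(x\rightharpoonup t)\wedge(s\rightharpoonup y))$, $(x,y)\Rightarrow(s,t)=((x\rightharpoonup s)\wedge(t\rightharpoonup y),x\wedge t)$, $\top=(\top,\bot)$, $\bot=(\bot,\top)$, and modal operators $\blacksquare(x,y)=(\square x,\Diamond y)$, $\Diamond_N(x,y)=(\Diamond x,\square y)$; this is the MN-lattice $\mathbf{N}(\mathbf{M},F)$. Given an MN-lattice $\mathbf{N}$, $\mathbf{H}^*$ is the Heyting algebra on $H^*=\{a\in A: a^2=a\}$ with $a\vee^*b=(a\vee b)^2$, $a\wedge^*b=(a\wedge b)^2$, $a\rightharpoonup^*b=(a^2\Rightarrow b)^2$, constants $\bot,\top$; and $\mathbf{M}_\mathbf{N}^*=\langle\mathbf{H}^*,\square^*,\Diamond^*\rangle$ with $\square^*a=(\blacksquare a)^2$, $\Diamond^*a=(\Diamond_N a)^2$, which is a modal Heyting algebra. -}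

module Defs where

open import Level using (Level; suc)
open import Data.Product using (Σ; _×_; _,_; proj₁; proj₂; ∃)
open import Relation.Binary.PropositionalEquality using (_≡_)


record NelsonLattice (ℓ : Level) : Set (suc ℓ) where
  field
    A   : Set ℓ
    _∧_ : A → A → A
    _∨_ : A → A → A
    _*_ : A → A → A
    _⇒_ : A → A → A
    ⊤   : A
    ⊥   : A

  _≤_ : A → A → Set ℓ
  a ≤ b = (a ∧ b) ≡ a

  ∼_ : A → A
  ∼ a = a ⇒ ⊥

  _² : A → A
  a ² = a * a

  field
    ∧-assoc : ∀ a b c → ((a ∧ b) ∧ c) ≡ (a ∧ (b ∧ c))
    ∨-assoc : ∀ a b c → ((a ∨ b) ∨ c) ≡ (a ∨ (b ∨ c))
    ∧-comm  : ∀ a b → (a ∧ b) ≡ (b ∧ a)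
    ∨-comm  : ∀ a b → (a ∨ b) ≡ (b ∨ a)
    ∧-absorb-∨ : ∀ a b → (a ∧ (a ∨ b)) ≡ a
    ∨-absorb-∧ : ∀ a b → (a ∨ (a ∧ b)) ≡ a
    ⊥-least : ∀ a → ⊥ ≤ a
    ⊤-greatest : ∀ a → a ≤ ⊤
    *-assoc : ∀ a b c → ((a * b) * c) ≡ (a * (b * c))
    *-comm  : ∀ a b → (a * b) ≡ (b * a)
    *-identity : ∀ a → (a * ⊤) ≡ a
    residuation-⇒ : ∀ a b c → (a * b) ≤ c → a ≤ (b ⇒ c)
    residuation-⇐ : ∀ a b c → a ≤ (b ⇒ c) → (a * b) ≤ c
    involutive : ∀ a → (∼ (∼ a)) ≡ a
    nelson : ∀ a b →
      ((((a ²) ⇒ b) ∧ (((∼ b) ²) ⇒ (∼ a))) ⇒ (a ⇒ b)) ≡ ⊤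

record MNLattice (ℓ : Level) : Set (suc ℓ) where
  field
    nelsonLattice : NelsonLattice ℓ
  open NelsonLattice nelsonLattice public
  field
    ■ : A → A
    ◆ : A → A
    mN1 : ∀ a → ◆ a ≡ (∼ (■ (∼ a)))
    mN2-■ : ∀ a b → (a ²) ≡ (b ²) → ((■ a) ²) ≡ ((■ b) ²)
    mN2-◆ : ∀ a b → (a ²) ≡ (b ²) → ((◆ a) ²) ≡ ((◆ b) ²)
    mN3 : ∀ a b → ((■ a ∧ ◆ ((∼ (a ²)) ∧ b)) ²) ≡ ⊥

module Construction {ℓ : Level} (N : MNLattice ℓ) where
  open MNLattice N

  InH* : A → Set ℓ
  InH* a = (a ²) ≡ a

  _∨*_ : A → A → A
  a ∨* b = (a ∨ b) ²

  _∧*_ : A → A → A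
  a ∧* b = (a ∧ b) ²

  _⇀*_ : A → A → A
  a ⇀* b = ((a ²) ⇒ b) ²

  □* : A → A
  □* a = (■ a) ²

  ◇* : A → A
  ◇* a = (◆ a) ²

  InF* : A → Set ℓ
  InF* x = Σ A (λ a → x ≡ ((a ∨ (∼ a)) ²))

  InR : A × A → Set ℓ
  InR (x , y) = InH* x × InH* y × ((x ∧* y) ≡ ⊥) × InF* (x ∨* y)

  _∨R_ : A × A → A × A → A × A
  (x , y) ∨R (s , t) = (x ∨* s , y ∧* t)

  _∧R_ : A × A → A × A → A × A
  (x , y) ∧R (s , t) = (x ∧* s , y ∨* t)

  _*R_ : A × A → A × A → A × A
  (x , y) *R (s , t) = (x ∧* s , (x ⇀* t) ∧* (s ⇀* y))

  _⇒R_ : A × A → A × A → A × A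
  (x , y) ⇒R (s , t) = ((x ⇀* s) ∧* (t ⇀* y) , x ∧* t)

  ⊤R : A × A
  ⊤R = (⊤ , ⊥)

  ⊥R : A × A
  ⊥R = (⊥ , ⊤)

  ■R : A × A → A × A
  ■R (x , y) = (□* x , ◇* y)

  ◆R : A × A → A × A
  ◆R (x , y) = (◇* x , □* y)

  h : A → A × A
  h a = (a ² , (∼ a) ²)

  record IsIsomorphism : Set ℓ where
    field
      into       : ∀ a → InR (h a)
      injective  : ∀ a b → h a ≡ h b → a ≡ b
      surjective : ∀ p → InR p → Σ A (λ a → h a ≡ p)
      hom-∧ : ∀ a b → h (a ∧ b) ≡ (h a ∧R h b)
      hom-∨ : ∀ a b → h (a ∨ b) ≡ (h a ∨R h b)
      hom-* : ∀ a b → h (a * b) ≡ (h a *R h b)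
      hom-⇒ : ∀ a b → h (a ⇒ b) ≡ (h a ⇒R h b)
      hom-⊤ : h ⊤ ≡ ⊤R
      hom-⊥ : h ⊥ ≡ ⊥R
      hom-■ : ∀ a → h (■ a) ≡ ■R (h a)
      hom-◆ : ∀ a → h (◆ a) ≡ ◆R (h a)

{-# OPTIONS --safe #-}
-- Squaring is an interior operator on a Nelson lattice: a³ = a², so the
-- squares form a Heyting algebra H* in which a * b and a ∧ b have the same
-- square, and by Nelson's rule (a² ≤ b and (∼b)² ≤ ∼a give a ≤ b) an element a
-- is determined by the pair (a², (∼a)²). Every operation is then computed
-- componentwise on such pairs; for ⇒ this is the Nelson identity read as the
-- equation a ⇒ b = (a² ⇒ b) ∧ ((∼b)² ⇒ ∼a). A pair (x , y) of R(H*, F*) with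
-- (x ∨ y)² = (c ∨ ∼c)² is the image of ∼y ∧ (c ∨ ∼c), because ∼(c ∨ ∼c) has
-- square ⊥.
module Submission where

open import Level using (Level)
open import Defs
open import Data.Product using (Σ; _,_; proj₁; proj₂)
open import Relation.Binary.PropositionalEquality
  using (_≡_; sym; trans; cong; cong₂; isEquivalence)
open import Algebra.Bundles using (CommutativeSemigroup)
import Algebra.Properties.CommutativeSemigroup as CommutativeSemigroupProperties
open import Algebra.Lattice.Bundles using (Lattice)
open import Algebra.Lattice.Properties.Lattice using (∨-∧-orderTheoreticLattice)
import Relation.Binary.Lattice as Order
import Relation.Binary.Lattice.Properties.JoinSemilattice as JoinSemilatticeProperties
import Relation.Binary.Reasoning.PartialOrder as ≤-Reasoning

module NelsonLatticeProperties {ℓ : Level} (L : NelsonLattice ℓ) where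
  open NelsonLattice L

  private
    lattice : Lattice ℓ ℓ
    lattice = record
      { Carrier   = A
      ; _≈_       = _≡_
      ; _∨_       = _∨_
      ; _∧_       = _∧_
      ; isLattice = record
        { isEquivalence = isEquivalence
        ; ∨-comm        = ∨-comm
        ; ∨-assoc       = ∨-assoc
        ; ∨-cong        = cong₂ _∨_
        ; ∧-comm        = ∧-comm
        ; ∧-assoc       = ∧-assoc
        ; ∧-cong        = cong₂ _∧_
        ; absorptive    = ∨-absorb-∧ , ∧-absorb-∨
        }
      }

    module ⊑ = Order.Lattice (∨-∧-orderTheoreticLattice lattice)

  -- The library orders a lattice by a ≡ a ∧ b, the Nelson lattice record by
  -- (a ∧ b) ≡ a; the two differ only by sym.
  orderLattice : Order.Lattice ℓ ℓ ℓ
  orderLattice = record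
    { Carrier   = A
    ; _≈_       = _≡_
    ; _≤_       = _≤_
    ; _∨_       = _∨_
    ; _∧_       = _∧_
    ; isLattice = record
      { isPartialOrder = record
        { isPreorder = record
          { isEquivalence = isEquivalence
          ; reflexive     = λ p → sym (⊑.reflexive p)
          ; trans         = λ p q → sym (⊑.trans (sym p) (sym q))
          }
        ; antisym = λ p q → ⊑.antisym (sym p) (sym q)
        }
      ; supremum = λ a b →
          sym (⊑.x≤x∨y a b) , sym (⊑.y≤x∨y a b) , λ _ p q → sym (⊑.∨-least (sym p) (sym q))
      ; infimum = λ a b →
          sym (⊑.x∧y≤x a b) , sym (⊑.x∧y≤y a b) , λ _ p q → sym (⊑.∧-greatest (sym p) (sym q))
      }
    }

  open Order.Lattice orderLattice public
    using (poset; x∧y≤x; x∧y≤y; ∧-greatest; x≤x∨y; y≤x∨y; ∨-least)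
    renaming (refl to ≤-refl; reflexive to ≤-reflexive; trans to ≤-trans; antisym to ≤-antisym)
  open JoinSemilatticeProperties (Order.Lattice.joinSemilattice orderLattice)
    using (∨-monotonic; x≤y⇒x∨y≈y)
  open ≤-Reasoning poset

  ∨-identityʳ : ∀ a → (a ∨ ⊥) ≡ a
  ∨-identityʳ a = trans (∨-comm a ⊥) (x≤y⇒x∨y≈y (⊥-least a))

  private
    *-commutativeSemigroup : CommutativeSemigroup ℓ ℓ
    *-commutativeSemigroup = record
      { Carrier                = A
      ; _≈_                    = _≡_
      ; _∙_                    = _*_
      ; isCommutativeSemigroup = record
        { isSemigroup = record
          { isMagma = record { isEquivalence = isEquivalence ; ∙-cong = cong₂ _*_ }
          ; assoc   = *-assoc
          }
        ; comm = *-comm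
        }
      }

  open CommutativeSemigroupProperties *-commutativeSemigroup using (interchange; xy∙z≈xz∙y)

  *-identityˡ : ∀ a → (⊤ * a) ≡ a
  *-identityˡ a = trans (*-comm ⊤ a) (*-identity a)

  ⇒-eval : ∀ a b → ((a ⇒ b) * a) ≤ b
  ⇒-eval a b = residuation-⇐ (a ⇒ b) a b ≤-refl

  x*∼x≤⊥ : ∀ a → (a * (∼ a)) ≤ ⊥
  x*∼x≤⊥ a = begin
    a * (∼ a)   ≡⟨ *-comm a (∼ a) ⟩
    (∼ a) * a   ≤⟨ ⇒-eval a ⊥ ⟩
    ⊥           ∎

  *-monoˡ-≤ : ∀ {a b} c → a ≤ b → (a * c) ≤ (b * c)
  *-monoˡ-≤ {a} {b} c a≤b =
    residuation-⇐ a c (b * c) (≤-trans a≤b (residuation-⇒ b c (b * c) ≤-refl))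

  *-monoʳ-≤ : ∀ {a b} c → a ≤ b → (c * a) ≤ (c * b)
  *-monoʳ-≤ {a} {b} c a≤b = begin
    c * a   ≡⟨ *-comm c a ⟩
    a * c   ≤⟨ *-monoˡ-≤ c a≤b ⟩
    b * c   ≡⟨ *-comm b c ⟩
    c * b   ∎

  *-mono-≤ : ∀ {a b c d} → a ≤ b → c ≤ d → (a * c) ≤ (b * d)
  *-mono-≤ {b = b} {c = c} a≤b c≤d = ≤-trans (*-monoˡ-≤ c a≤b) (*-monoʳ-≤ b c≤d)

  x*y≤x : ∀ a b → (a * b) ≤ a
  x*y≤x a b = begin
    a * b   ≤⟨ *-monoʳ-≤ a (⊤-greatest b) ⟩
    a * ⊤   ≡⟨ *-identity a ⟩
    a       ∎

  x*y≤y : ∀ a b → (a * b) ≤ b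
  x*y≤y a b = begin
    a * b   ≡⟨ *-comm a b ⟩
    b * a   ≤⟨ x*y≤x b a ⟩
    b       ∎

  ⇒-monoʳ-≤ : ∀ a {b c} → b ≤ c → (a ⇒ b) ≤ (a ⇒ c)
  ⇒-monoʳ-≤ a {b} b≤c = residuation-⇒ (a ⇒ b) a _ (≤-trans (⇒-eval a b) b≤c)

  ⇒-antimonoˡ-≤ : ∀ {a b} c → a ≤ b → (b ⇒ c) ≤ (a ⇒ c)
  ⇒-antimonoˡ-≤ {a} {b} c a≤b =
    residuation-⇒ (b ⇒ c) a c (≤-trans (*-monoʳ-≤ (b ⇒ c) a≤b) (⇒-eval b c))

  ∼-antimono-≤ : ∀ {a b} → a ≤ b → (∼ b) ≤ (∼ a)
  ∼-antimono-≤ = ⇒-antimonoˡ-≤ ⊥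

  ⊤≤⇒-intro : ∀ {a b} → a ≤ b → ⊤ ≤ (a ⇒ b)
  ⊤≤⇒-intro {a} {b} a≤b = residuation-⇒ ⊤ a b (≤-trans (≤-reflexive (*-identityˡ a)) a≤b)

  ⊤≤⇒-elim : ∀ {a b} → ⊤ ≤ (a ⇒ b) → a ≤ b
  ⊤≤⇒-elim {a} {b} ⊤≤a⇒b = begin
    a         ≡⟨ sym (*-identityˡ a) ⟩
    ⊤ * a     ≤⟨ residuation-⇐ ⊤ a b ⊤≤a⇒b ⟩
    b         ∎

  *-distribˡ-∨ : ∀ a b c → (a * (b ∨ c)) ≡ ((a * b) ∨ (a * c))
  *-distribˡ-∨ a b c = ≤-antisym
    (begin
      a * (b ∨ c)   ≡⟨ *-comm a (b ∨ c) ⟩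
      (b ∨ c) * a   ≤⟨ residuation-⇐ (b ∨ c) a _ (∨-least (into (x≤x∨y _ _)) (into (y≤x∨y _ _))) ⟩
      (a * b) ∨ (a * c) ∎)
    (∨-least (*-monoʳ-≤ a (x≤x∨y b c)) (*-monoʳ-≤ a (y≤x∨y b c)))
    where
    into : ∀ {x z} → (a * x) ≤ z → x ≤ (a ⇒ z)
    into {x} ax≤z = residuation-⇒ x a _ (≤-trans (≤-reflexive (*-comm x a)) ax≤z)

  *-distribʳ-∨ : ∀ a b c → ((b ∨ c) * a) ≡ ((b * a) ∨ (c * a))
  *-distribʳ-∨ a b c = begin-equality
    (b ∨ c) * a         ≡⟨ *-comm (b ∨ c) a ⟩
    a * (b ∨ c)         ≡⟨ *-distribˡ-∨ a b c ⟩
    (a * b) ∨ (a * c)   ≡⟨ cong₂ _∨_ (*-comm a b) (*-comm a c) ⟩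
    (b * a) ∨ (c * a)   ∎

  ⇒-curry : ∀ a b c → ((a * b) ⇒ c) ≡ (a ⇒ (b ⇒ c))
  ⇒-curry a b c = ≤-antisym
    (residuation-⇒ _ a _ (residuation-⇒ _ b c (begin
      (((a * b) ⇒ c) * a) * b   ≡⟨ *-assoc _ a b ⟩
      ((a * b) ⇒ c) * (a * b)   ≤⟨ ⇒-eval (a * b) c ⟩
      c                         ∎)))
    (residuation-⇒ _ (a * b) c (begin
      (a ⇒ (b ⇒ c)) * (a * b)   ≡⟨ sym (*-assoc _ a b) ⟩
      ((a ⇒ (b ⇒ c)) * a) * b   ≤⟨ *-monoˡ-≤ b (⇒-eval a (b ⇒ c)) ⟩
      (b ⇒ c) * b               ≤⟨ ⇒-eval b c ⟩
      c                         ∎))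

  ∼-* : ∀ a b → (∼ (a * b)) ≡ (a ⇒ (∼ b))
  ∼-* a b = ⇒-curry a b ⊥

  ∼-⇒ : ∀ a b → (∼ (a ⇒ b)) ≡ (a * (∼ b))
  ∼-⇒ a b = begin-equality
    ∼ (a ⇒ b)               ≡⟨ cong (λ c → ∼ (a ⇒ c)) (sym (involutive b)) ⟩
    ∼ (a ⇒ (∼ (∼ b)))       ≡⟨ cong ∼_ (sym (∼-* a (∼ b))) ⟩
    ∼ (∼ (a * (∼ b)))       ≡⟨ involutive (a * (∼ b)) ⟩
    a * (∼ b)               ∎

  ⇒-contrapositive : ∀ a b → (a ⇒ b) ≡ ((∼ b) ⇒ (∼ a))
  ⇒-contrapositive a b = begin-equality
    a ⇒ b                   ≡⟨ sym (involutive (a ⇒ b)) ⟩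
    ∼ (∼ (a ⇒ b))           ≡⟨ cong ∼_ (∼-⇒ a b) ⟩
    ∼ (a * (∼ b))           ≡⟨ cong ∼_ (*-comm a (∼ b)) ⟩
    ∼ ((∼ b) * a)           ≡⟨ ∼-* (∼ b) a ⟩
    (∼ b) ⇒ (∼ a)           ∎

  de-morgan₁ : ∀ a b → (∼ (a ∨ b)) ≡ ((∼ a) ∧ (∼ b))
  de-morgan₁ a b = ≤-antisym
    (∧-greatest (∼-antimono-≤ (x≤x∨y a b)) (∼-antimono-≤ (y≤x∨y a b)))
    (residuation-⇒ _ (a ∨ b) ⊥ (begin
      ((∼ a) ∧ (∼ b)) * (a ∨ b)
        ≡⟨ *-distribˡ-∨ _ a b ⟩
      (((∼ a) ∧ (∼ b)) * a) ∨ (((∼ a) ∧ (∼ b)) * b)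
        ≤⟨ ∨-least (≤-trans (*-monoˡ-≤ a (x∧y≤x _ _)) (⇒-eval a ⊥))
                   (≤-trans (*-monoˡ-≤ b (x∧y≤y _ _)) (⇒-eval b ⊥)) ⟩
      ⊥ ∎))

  de-morgan₂ : ∀ a b → (∼ (a ∧ b)) ≡ ((∼ a) ∨ (∼ b))
  de-morgan₂ a b = begin-equality
    ∼ (a ∧ b)                     ≡⟨ cong ∼_ (cong₂ _∧_ (sym (involutive a)) (sym (involutive b))) ⟩
    ∼ ((∼ (∼ a)) ∧ (∼ (∼ b)))     ≡⟨ cong ∼_ (sym (de-morgan₁ (∼ a) (∼ b))) ⟩
    ∼ (∼ ((∼ a) ∨ (∼ b)))         ≡⟨ involutive _ ⟩
    (∼ a) ∨ (∼ b)                 ∎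

  ∼⊤≡⊥ : (∼ ⊤) ≡ ⊥
  ∼⊤≡⊥ = ≤-antisym
    (≤-trans (≤-reflexive (sym (*-identity (∼ ⊤)))) (⇒-eval ⊤ ⊥))
    (⊥-least (∼ ⊤))

  ∼⊥≡⊤ : (∼ ⊥) ≡ ⊤
  ∼⊥≡⊤ = trans (cong ∼_ (sym ∼⊤≡⊥)) (involutive ⊤)

  nelson-rule : ∀ {a b} → (a ²) ≤ b → ((∼ b) ²) ≤ (∼ a) → a ≤ b
  nelson-rule {a} {b} a²≤b ∼b²≤∼a = ⊤≤⇒-elim (begin
    ⊤                                   ≤⟨ ∧-greatest (⊤≤⇒-intro a²≤b) (⊤≤⇒-intro ∼b²≤∼a) ⟩
    ((a ²) ⇒ b) ∧ (((∼ b) ²) ⇒ (∼ a))   ≤⟨ ⊤≤⇒-elim (≤-reflexive (sym (nelson a b))) ⟩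
    a ⇒ b                               ∎)

  x²≤x : ∀ a → (a ²) ≤ a
  x²≤x a = x*y≤x a a

  ²-mono-≤ : ∀ {a b} → a ≤ b → (a ²) ≤ (b ²)
  ²-mono-≤ a≤b = *-mono-≤ a≤b a≤b

  nelson-⇒ : ∀ a b → (a ⇒ b) ≡ (((a ²) ⇒ b) ∧ (((∼ b) ²) ⇒ (∼ a)))
  nelson-⇒ a b = ≤-antisym
    (∧-greatest
      (⇒-antimonoˡ-≤ b (x²≤x a))
      (≤-trans (≤-reflexive (⇒-contrapositive a b)) (⇒-antimonoˡ-≤ (∼ a) (x²≤x (∼ b)))))
    (⊤≤⇒-elim (≤-reflexive (sym (nelson a b))))

  -- Nelson's rule for a ≤ a ⇒ a³, whose premiss (∼(a ⇒ a³))² ≤ ∼a holds since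
  -- ∼(a ⇒ a³) = a * ∼a³.
  x²*x≡x² : ∀ a → ((a ²) * a) ≡ (a ²)
  x²*x≡x² a = ≤-antisym (x*y≤x (a ²) a) (residuation-⇐ a a c a≤a⇒c)
    where
    c : A
    c = (a ²) * a
    a≤a⇒c : a ≤ (a ⇒ c)
    a≤a⇒c = nelson-rule (residuation-⇒ (a ²) a c ≤-refl)
      (residuation-⇒ _ a ⊥ (begin
        ((∼ (a ⇒ c)) ²) * a                 ≡⟨ cong (λ d → (d ²) * a) (∼-⇒ a c) ⟩
        ((a * (∼ c)) ²) * a                 ≡⟨ cong (_* a) (interchange a (∼ c) a (∼ c)) ⟩
        ((a ²) * ((∼ c) ²)) * a             ≡⟨ xy∙z≈xz∙y (a ²) ((∼ c) ²) a ⟩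
        c * ((∼ c) ²)                       ≤⟨ *-monoʳ-≤ c (x²≤x (∼ c)) ⟩
        c * (∼ c)                           ≤⟨ x*∼x≤⊥ c ⟩
        ⊥                                   ∎))

  ²-idem : ∀ a → ((a ²) ²) ≡ (a ²)
  ²-idem a = begin-equality
    (a ²) * (a * a)     ≡⟨ sym (*-assoc (a ²) a a) ⟩
    ((a ²) * a) * a     ≡⟨ cong (_* a) (x²*x≡x² a) ⟩
    (a ²) * a           ≡⟨ x²*x≡x² a ⟩
    a ²                 ∎

  idem-≤⇒≤² : ∀ {e a} → (e ²) ≡ e → e ≤ a → e ≤ (a ²)
  idem-≤⇒≤² {e} {a} e²≡e e≤a = begin
    e       ≡⟨ sym e²≡e ⟩
    e ²     ≤⟨ ²-mono-≤ e≤a ⟩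
    a ²     ∎

  ²-distrib-* : ∀ a b → ((a * b) ²) ≡ ((a ²) * (b ²))
  ²-distrib-* a b = interchange a b a b

  ²-∧ : ∀ a b → ((a ∧ b) ²) ≡ ((a ²) * (b ²))
  ²-∧ a b = ≤-antisym
    (begin
      (a ∧ b) ²                   ≡⟨ sym (²-idem (a ∧ b)) ⟩
      ((a ∧ b) ²) * ((a ∧ b) ²)   ≤⟨ *-mono-≤ (²-mono-≤ (x∧y≤x a b)) (²-mono-≤ (x∧y≤y a b)) ⟩
      (a ²) * (b ²)               ∎)
    (idem-≤⇒≤² a²b²-idem (∧-greatest
      (≤-trans (x*y≤x (a ²) (b ²)) (x²≤x a))
      (≤-trans (x*y≤y (a ²) (b ²)) (x²≤x b))))
    where
    a²b²-idem : (((a ²) * (b ²)) ²) ≡ ((a ²) * (b ²))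
    a²b²-idem = trans (²-distrib-* (a ²) (b ²)) (cong₂ _*_ (²-idem a) (²-idem b))

  ²-*≡²-∧ : ∀ a b → ((a * b) ²) ≡ ((a ∧ b) ²)
  ²-*≡²-∧ a b = trans (²-distrib-* a b) (sym (²-∧ a b))

  ²-∧-squares : ∀ a b → ((a ∧ b) ²) ≡ (((a ²) ∧ (b ²)) ²)
  ²-∧-squares a b = begin-equality
    (a ∧ b) ²                   ≡⟨ ²-∧ a b ⟩
    (a ²) * (b ²)               ≡⟨ cong₂ _*_ (sym (²-idem a)) (sym (²-idem b)) ⟩
    ((a ²) ²) * ((b ²) ²)       ≡⟨ sym (²-∧ (a ²) (b ²)) ⟩
    ((a ²) ∧ (b ²)) ²           ∎

  -- Nelson's rule for a * ∼(a² ∨ b²) ≤ ∼b.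
  x*y≤x²∨y² : ∀ a b → (a * b) ≤ ((a ²) ∨ (b ²))
  x*y≤x²∨y² a b = begin
    a * b         ≤⟨ residuation-⇒ (a * b) z ⊥ (begin
                       (a * b) * z    ≡⟨ xy∙z≈xz∙y a b z ⟩
                       (a * z) * b    ≤⟨ residuation-⇐ (a * z) b ⊥ az≤∼b ⟩
                       ⊥              ∎) ⟩
    ∼ z           ≡⟨ involutive _ ⟩
    (a ²) ∨ (b ²) ∎
    where
    z : A
    z = ∼ ((a ²) ∨ (b ²))
    az≤∼b : (a * z) ≤ (∼ b)
    az≤∼b = nelson-rule
      (residuation-⇒ _ b ⊥ (begin
        ((a * z) ²) * b           ≤⟨ x*y≤x _ b ⟩
        (a * z) ²                 ≡⟨ ²-distrib-* a z ⟩
        (a ²) * (z ²)             ≤⟨ *-monoʳ-≤ (a ²) (x²≤x z) ⟩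
        (a ²) * z                 ≤⟨ *-monoˡ-≤ z (x≤x∨y (a ²) (b ²)) ⟩
        ((a ²) ∨ (b ²)) * z       ≡⟨ *-comm _ z ⟩
        z * ((a ²) ∨ (b ²))       ≤⟨ ⇒-eval _ ⊥ ⟩
        ⊥                         ∎))
      (residuation-⇒ _ (a * z) ⊥ (begin
        ((∼ (∼ b)) ²) * (a * z)   ≡⟨ cong (λ d → (d ²) * (a * z)) (involutive b) ⟩
        (b ²) * (a * z)           ≤⟨ *-monoʳ-≤ (b ²) (x*y≤y a z) ⟩
        (b ²) * z                 ≤⟨ *-monoˡ-≤ z (y≤x∨y (a ²) (b ²)) ⟩
        ((a ²) ∨ (b ²)) * z       ≡⟨ *-comm _ z ⟩
        z * ((a ²) ∨ (b ²))       ≤⟨ ⇒-eval _ ⊥ ⟩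
        ⊥                         ∎))

  ²-∨ : ∀ a b → ((a ∨ b) ²) ≡ (((a ²) ∨ (b ²)) ²)
  ²-∨ a b = ≤-antisym
    (idem-≤⇒≤² (²-idem (a ∨ b)) (begin
      (a ∨ b) * (a ∨ b)                     ≡⟨ *-distribʳ-∨ (a ∨ b) a b ⟩
      (a * (a ∨ b)) ∨ (b * (a ∨ b))         ≡⟨ cong₂ _∨_ (*-distribˡ-∨ a a b) (*-distribˡ-∨ b a b) ⟩
      ((a ²) ∨ (a * b)) ∨ ((b * a) ∨ (b ²)) ≤⟨ ∨-least (∨-least (x≤x∨y _ _) ab≤)
                                                       (∨-least ba≤ (y≤x∨y _ _)) ⟩
      (a ²) ∨ (b ²)                         ∎))
    (²-mono-≤ (∨-monotonic (x²≤x a) (x²≤x b)))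
    where
    ab≤ : (a * b) ≤ ((a ²) ∨ (b ²))
    ab≤ = x*y≤x²∨y² a b
    ba≤ : (b * a) ≤ ((a ²) ∨ (b ²))
    ba≤ = ≤-trans (≤-reflexive (*-comm b a)) ab≤

  ²-⇒-idem : ∀ {e} u → (e ²) ≡ e → ((e ⇒ u) ²) ≡ ((e ⇒ (u ²)) ²)
  ²-⇒-idem {e} u e²≡e = ≤-antisym
    (idem-≤⇒≤² (²-idem (e ⇒ u)) (residuation-⇒ _ e _ (idem-≤⇒≤² idem (begin
      ((e ⇒ u) ²) * e           ≤⟨ *-monoˡ-≤ e (x²≤x (e ⇒ u)) ⟩
      (e ⇒ u) * e               ≤⟨ ⇒-eval e u ⟩
      u                         ∎))))
    (²-mono-≤ (⇒-monoʳ-≤ e (x²≤x u)))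
    where
    idem : ((((e ⇒ u) ²) * e) ²) ≡ (((e ⇒ u) ²) * e)
    idem = trans (²-distrib-* _ e) (cong₂ _*_ (²-idem (e ⇒ u)) e²≡e)

  ²-⇒ : ∀ a b →
    ((a ⇒ b) ²) ≡ (((((a ²) ⇒ (b ²)) ²) ∧ ((((∼ b) ²) ⇒ ((∼ a) ²)) ²)) ²)
  ²-⇒ a b = begin-equality
    (a ⇒ b) ²
      ≡⟨ cong _² (nelson-⇒ a b) ⟩
    (((a ²) ⇒ b) ∧ (((∼ b) ²) ⇒ (∼ a))) ²
      ≡⟨ ²-∧-squares _ _ ⟩
    ((((a ²) ⇒ b) ²) ∧ ((((∼ b) ²) ⇒ (∼ a)) ²)) ²
      ≡⟨ cong₂ (λ p q → (p ∧ q) ²) (²-⇒-idem b (²-idem a)) (²-⇒-idem (∼ a) (²-idem (∼ b))) ⟩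
    ((((a ²) ⇒ (b ²)) ²) ∧ ((((∼ b) ²) ⇒ ((∼ a) ²)) ²)) ²
      ∎

  ⊥²≡⊥ : (⊥ ²) ≡ ⊥
  ⊥²≡⊥ = ≤-antisym (x²≤x ⊥) (⊥-least _)

  [x∧∼x]²≡⊥ : ∀ a → ((a ∧ (∼ a)) ²) ≡ ⊥
  [x∧∼x]²≡⊥ a = ≤-antisym
    (begin
      (a ∧ (∼ a)) ²         ≡⟨ ²-∧ a (∼ a) ⟩
      (a ²) * ((∼ a) ²)     ≤⟨ *-mono-≤ (x²≤x a) (x²≤x (∼ a)) ⟩
      a * (∼ a)             ≤⟨ x*∼x≤⊥ a ⟩
      ⊥                     ∎)
    (⊥-least _)

  ≡-by-squares : ∀ {a b} → (a ²) ≡ (b ²) → ((∼ a) ²) ≡ ((∼ b) ²) → a ≡ b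
  ≡-by-squares {a} {b} a²≡b² ∼a²≡∼b² = ≤-antisym (≤-by-squares a²≡b² ∼a²≡∼b²)
    (≤-by-squares (sym a²≡b²) (sym ∼a²≡∼b²))
    where
    ≤-by-squares : ∀ {x y} → (x ²) ≡ (y ²) → ((∼ x) ²) ≡ ((∼ y) ²) → x ≤ y
    ≤-by-squares {x} {y} x²≡y² ∼x²≡∼y² = nelson-rule
      (≤-trans (≤-reflexive x²≡y²) (x²≤x y))
      (≤-trans (≤-reflexive (sym ∼x²≡∼y²)) (x²≤x (∼ x)))

module Representation {ℓ : Level} (N : MNLattice ℓ) where
  open MNLattice N
  open NelsonLatticeProperties nelsonLattice
  open Construction N
  open ≤-Reasoning poset

  ⇀*-of-square : ∀ a b → ((a ²) ⇀* b) ≡ (((a ²) ⇒ b) ²)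
  ⇀*-of-square a b = cong (λ e → (e ⇒ b) ²) (²-idem a)

  ∼■ : ∀ a → (∼ (■ a)) ≡ (◆ (∼ a))
  ∼■ a = sym (trans (mN1 (∼ a)) (cong (λ b → ∼ (■ b)) (involutive a)))

  ∼◆ : ∀ a → (∼ (◆ a)) ≡ (■ (∼ a))
  ∼◆ a = trans (cong ∼_ (mN1 a)) (involutive _)

  □*-square : ∀ a → □* a ≡ □* (a ²)
  □*-square a = mN2-■ a (a ²) (sym (²-idem a))

  ◇*-square : ∀ a → ◇* a ≡ ◇* (a ²)
  ◇*-square a = mN2-◆ a (a ²) (sym (²-idem a))

  h-InR : ∀ a → InR (h a)
  h-InR a = ²-idem a , ²-idem (∼ a)
    , trans (sym (²-∧-squares a (∼ a))) ([x∧∼x]²≡⊥ a)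
    , (a , sym (²-∨ a (∼ a)))

  h-injective : ∀ a b → h a ≡ h b → a ≡ b
  h-injective a b ha≡hb = ≡-by-squares (cong proj₁ ha≡hb) (cong proj₂ ha≡hb)

  h-surjective : ∀ p → InR p → Σ A (λ a → h a ≡ p)
  h-surjective (x , y) (x²≡x , y²≡y , x∧*y≡⊥ , (c , x∨*y≡k²)) =
    (∼ y) ∧ k , cong₂ _,_ (≤-antisym a²≤x x≤a²) ∼a²≡y
    where
    k : A
    k = c ∨ (∼ c)

    x*y≡⊥ : (x * y) ≡ ⊥
    x*y≡⊥ = trans (sym (trans (²-∧ x y) (cong₂ _*_ x²≡x y²≡y))) x∧*y≡⊥

    x≤a² : x ≤ (((∼ y) ∧ k) ²)
    x≤a² = idem-≤⇒≤² x²≡x (∧-greatest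
      (residuation-⇒ x y ⊥ (≤-reflexive x*y≡⊥))
      (begin
        x             ≤⟨ idem-≤⇒≤² x²≡x (x≤x∨y x y) ⟩
        (x ∨ y) ²     ≡⟨ x∨*y≡k² ⟩
        k ²           ≤⟨ x²≤x k ⟩
        k             ∎))

    a²≤x : (((∼ y) ∧ k) ²) ≤ x
    a²≤x = begin
      ((∼ y) ∧ k) ²               ≡⟨ ²-∧ (∼ y) k ⟩
      ((∼ y) ²) * (k ²)           ≤⟨ *-mono-≤ (x²≤x (∼ y)) (≤-reflexive (sym x∨*y≡k²)) ⟩
      (∼ y) * ((x ∨ y) ²)         ≤⟨ *-monoʳ-≤ (∼ y) (x²≤x (x ∨ y)) ⟩
      (∼ y) * (x ∨ y)             ≡⟨ *-distribˡ-∨ (∼ y) x y ⟩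
      ((∼ y) * x) ∨ ((∼ y) * y)   ≤⟨ ∨-least (x*y≤y (∼ y) x) (≤-trans (⇒-eval y ⊥) (⊥-least x)) ⟩
      x                           ∎

    ∼a²≡y : ((∼ ((∼ y) ∧ k)) ²) ≡ y
    ∼a²≡y = begin-equality
      (∼ ((∼ y) ∧ k)) ²                     ≡⟨ cong _² (de-morgan₂ (∼ y) k) ⟩
      ((∼ (∼ y)) ∨ (∼ k)) ²                 ≡⟨ cong (λ d → (d ∨ (∼ k)) ²) (involutive y) ⟩
      (y ∨ (∼ k)) ²                         ≡⟨ ²-∨ y (∼ k) ⟩
      ((y ²) ∨ ((∼ k) ²)) ²                 ≡⟨ cong (λ d → ((y ²) ∨ (d ²)) ²) (de-morgan₁ c (∼ c)) ⟩
      ((y ²) ∨ (((∼ c) ∧ (∼ (∼ c))) ²)) ²   ≡⟨ cong (λ d → ((y ²) ∨ d) ²) ([x∧∼x]²≡⊥ (∼ c)) ⟩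
      ((y ²) ∨ ⊥) ²                         ≡⟨ cong _² (∨-identityʳ (y ²)) ⟩
      (y ²) ²                               ≡⟨ ²-idem y ⟩
      y ²                                   ≡⟨ y²≡y ⟩
      y                                     ∎

  h-∧ : ∀ a b → h (a ∧ b) ≡ (h a ∧R h b)
  h-∧ a b = cong₂ _,_ (²-∧-squares a b) (trans (cong _² (de-morgan₂ a b)) (²-∨ (∼ a) (∼ b)))

  h-∨ : ∀ a b → h (a ∨ b) ≡ (h a ∨R h b)
  h-∨ a b = cong₂ _,_ (²-∨ a b) (trans (cong _² (de-morgan₁ a b)) (²-∧-squares (∼ a) (∼ b)))

  h-* : ∀ a b → h (a * b) ≡ (h a *R h b)
  h-* a b = cong₂ _,_ (trans (²-*≡²-∧ a b) (²-∧-squares a b)) (begin-equality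
    (∼ (a * b)) ²
      ≡⟨ cong _² (∼-* a b) ⟩
    (a ⇒ (∼ b)) ²
      ≡⟨ ²-⇒ a (∼ b) ⟩
    ((((a ²) ⇒ ((∼ b) ²)) ²) ∧ ((((∼ (∼ b)) ²) ⇒ ((∼ a) ²)) ²)) ²
      ≡⟨ cong₂ (λ p q → (p ∧ q) ²) (sym (⇀*-of-square a _))
           (trans (cong (λ d → ((d ²) ⇒ ((∼ a) ²)) ²) (involutive b)) (sym (⇀*-of-square b _))) ⟩
    ((a ²) ⇀* ((∼ b) ²)) ∧* ((b ²) ⇀* ((∼ a) ²))
      ∎)

  h-⇒ : ∀ a b → h (a ⇒ b) ≡ (h a ⇒R h b)
  h-⇒ a b = cong₂ _,_
    (trans (²-⇒ a b)
      (cong₂ (λ p q → (p ∧ q) ²) (sym (⇀*-of-square a _)) (sym (⇀*-of-square (∼ b) _))))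
    (begin-equality
      (∼ (a ⇒ b)) ²             ≡⟨ cong _² (∼-⇒ a b) ⟩
      (a * (∼ b)) ²             ≡⟨ ²-*≡²-∧ a (∼ b) ⟩
      (a ∧ (∼ b)) ²             ≡⟨ ²-∧-squares a (∼ b) ⟩
      ((a ²) ∧ ((∼ b) ²)) ²     ∎)

  h-⊤ : h ⊤ ≡ ⊤R
  h-⊤ = cong₂ _,_ (*-identity ⊤) (trans (cong _² ∼⊤≡⊥) ⊥²≡⊥)

  h-⊥ : h ⊥ ≡ ⊥R
  h-⊥ = cong₂ _,_ ⊥²≡⊥ (trans (cong _² ∼⊥≡⊤) (*-identity ⊤))

  h-■ : ∀ a → h (■ a) ≡ ■R (h a)
  h-■ a = cong₂ _,_ (□*-square a) (trans (cong _² (∼■ a)) (◇*-square (∼ a)))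

  h-◆ : ∀ a → h (◆ a) ≡ ◆R (h a)
  h-◆ a = cong₂ _,_ (◇*-square a) (trans (cong _² (∼◆ a)) (□*-square (∼ a)))

theorem4 : ∀ {ℓ : Level} (N : MNLattice ℓ) → Construction.IsIsomorphism N
theorem4 N = record
  { into       = h-InR
  ; injective  = h-injective
  ; surjective = h-surjective
  ; hom-∧      = h-∧
  ; hom-∨      = h-∨
  ; hom-*      = h-*
  ; hom-⇒      = h-⇒
  ; hom-⊤      = h-⊤
  ; hom-⊥      = h-⊥
  ; hom-■      = h-■
  ; hom-◆      = h-◆
  }
  where open Representation N
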